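{- Let $n\ge 9$ and let $\mathcal{F}\subseteq\binom{[n]}{4}$ be contained in a family of the form $\mathcal{G}_2$ with core $A$. If $x_1\ne x_2$ in $[n]$ satisfy $d_{\{x_1,x_2\}}>2n-7$, then $\{x_1,x_2\}\subseteq A$.
   Context: For a $2$-set $E\subseteq[n]$ and $x\in[n]\setminus E$, the family of the form $\mathcal{G}_2$ with center $x$ and core $A=\{x\}\cup E$ is $\{G\in\binom{[n]}{4}:E\subseteq G\}\cup\{G\in\binom{[n]}{4}:x\in G,\ G\cap E\ne\emptyset\}$ (equivalently, the $4$-sets containing at least two elements of the $3$-set $A$). For $S\subseteq[n]$, $d_S$ denotes the number of members of $\mathcal{F}$ containing $S$. -}

module Defs where

open import Data.Nat using (ℕ)
open import Data.Fin using (Fin)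
open import Data.Fin.Subset using (Subset; _∈_; _⊆_; ∣_∣; ⁅_⁆; _∪_)
open import Data.Fin.Subset.Properties using (_⊆?_)
open import Data.List using (List; length; filter)
open import Data.List.Membership.Propositional renaming (_∈_ to _∈ₗ_)
open import Data.Product using (_×_)
open import Data.Sum using (_⊎_)
open import Relation.Binary.PropositionalEquality using (_≡_)

-- A family F ⊆ binom([n],4) is a duplicate-free list of 4-subsets
-- (duplicate-freeness and size are imposed as hypotheses in the statement).
Family : ℕ → Set
Family n = List (Subset n)

d : ∀ {n} → Family n → Subset n → ℕ
d F S = length (filter (S ⊆?_) F)

InG2 : ∀ {n} → Fin n → Fin n → Fin n → Subset n → Set
InG2 x e₁ e₂ G =
  ∣ G ∣ ≡ 4 × ((e₁ ∈ G × e₂ ∈ G) ⊎ (x ∈ G × (e₁ ∈ G ⊎ e₂ ∈ G)))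

core : ∀ {n} → Fin n → Fin n → Fin n → Subset n
core x e₁ e₂ = ⁅ x ⁆ ∪ (⁅ e₁ ⁆ ∪ ⁅ e₂ ⁆)

{-# OPTIONS --safe #-}
-- If x₁ ∉ A, every member of F through x₁ and x₂ meets every pair of
-- points of A, in particular a pair {b, c} with x₂ ∉ {b, c}.  Such a member
-- is {x₁, x₂, b} plus a fourth point, or {x₁, x₂, c} plus a fourth point
-- other than b; distinct members have distinct fourth points, so there are
-- at most (n − 3) + (n − 4) = 2n − 7 of them.
module Submission where

open import Defs
open import Data.Nat using (ℕ; _≤_; _>_; _∸_; _*_)
open import Data.Fin using (Fin)
open import Data.Fin.Subset using (Subset; _∈_; _⊆_; ∣_∣; ⁅_⁆; _∪_)
open import Data.List using (List)
open import Data.List.Relation.Unary.All using (All)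
open import Data.List.Relation.Unary.Unique.Propositional using (Unique)
open import Data.Product using (_×_)
open import Relation.Binary.PropositionalEquality using (_≡_; _≢_)

open import Data.Nat using (suc; _+_; _<_; z≤n; s≤s)
open import Data.Nat.Properties
  using (≤-trans; ≤-reflexive; +-mono-≤; +-identityʳ; +-suc; <⇒≱; ≤⇒≯; module ≤-Reasoning)
open import Data.Fin using (zero; suc) renaming (_≟_ to _≟ᶠ_)
open import Data.Fin.Properties using (any?)
open import Data.Fin.Subset using (_∉_; _-_; ∁; ⊥; inside; outside)
open import Data.Fin.Subset.Properties
  using (_∈?_; _⊆?_; x∈⁅x⁆; x∈⁅y⁆⇒x≡y; x≢y⇒x∉⁅y⁆; x∈p∪q⁺; x∈p∪q⁻; ∉⊥; ∪-identityˡ; ∪-comm; ⊆-antisym;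
         p⊆q⇒∣p∣≤∣q∣; p⊂q⇒∣p∣<∣q∣; ∣⁅x⁆∣≡1; ∣∁p∣≡n∸∣p∣; x∉p⇒x∈∁p; x∈p∧x≢y⇒x∈p-y; x∈p⇒∣p-x∣<∣p∣)
open import Data.List using (_∷_; []; length; filter)
import Data.List.Relation.Unary.All as All
open import Data.List.Relation.Unary.All using (_∷_; [])
open import Data.List.Relation.Unary.All.Properties using (all-filter; filter⁺)
open import Data.List.Relation.Unary.AllPairs using (_∷_; [])
import Data.List.Relation.Unary.Unique.Propositional.Properties as Unique
open import Data.Vec.Base using (_∷_; here; there)
open import Data.Product using (∃; ∃₂; _,_; proj₁; proj₂)
open import Data.Sum using (_⊎_; inj₁; inj₂; [_,_]; fromInj₂)
open import Data.Empty using (⊥-elim)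
open import Function using (_∘_)
open import Relation.Nullary using (Dec; yes; no; ¬?)
open import Relation.Nullary.Decidable using (_×-dec_; decidable-stable)
open import Relation.Unary using (Decidable)
open import Relation.Unary.Properties using (∁?)
open import Relation.Binary.PropositionalEquality using (refl; sym; trans; cong; subst)

private
  variable
    n : ℕ

x∉⁅y⁆∪p : {x y : Fin n} {p : Subset n} → x ≢ y → x ∉ p → x ∉ ⁅ y ⁆ ∪ p
x∉⁅y⁆∪p {y = y} {p} x≢y x∉p x∈ = [ x≢y ∘ x∈⁅y⁆⇒x≡y y , x∉p ] (x∈p∪q⁻ ⁅ y ⁆ p x∈)

x∈p⇒⁅x⁆⊆p : {x : Fin n} {p : Subset n} → x ∈ p → ⁅ x ⁆ ⊆ p
x∈p⇒⁅x⁆⊆p {x = x} {p} x∈p y∈⁅x⁆ = subst (_∈ p) (sym (x∈⁅y⁆⇒x≡y x y∈⁅x⁆)) x∈p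

p⊆r∧q⊆r⇒p∪q⊆r : {p q r : Subset n} → p ⊆ r → q ⊆ r → p ∪ q ⊆ r
p⊆r∧q⊆r⇒p∪q⊆r {p = p} {q} p⊆r q⊆r x∈p∪q = [ p⊆r , q⊆r ] (x∈p∪q⁻ p q x∈p∪q)

∣⁅x⁆∪p∣≡1+∣p∣ : {x : Fin n} {p : Subset n} → x ∉ p → ∣ ⁅ x ⁆ ∪ p ∣ ≡ suc ∣ p ∣
∣⁅x⁆∪p∣≡1+∣p∣ {x = zero}  {outside ∷ p} _   = cong (suc ∘ ∣_∣) (∪-identityˡ p)
∣⁅x⁆∪p∣≡1+∣p∣ {x = zero}  {inside ∷ p}  x∉p = ⊥-elim (x∉p here)
∣⁅x⁆∪p∣≡1+∣p∣ {x = suc x} {outside ∷ p} x∉p = ∣⁅x⁆∪p∣≡1+∣p∣ (x∉p ∘ there)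
∣⁅x⁆∪p∣≡1+∣p∣ {x = suc x} {inside ∷ p}  x∉p = cong suc (∣⁅x⁆∪p∣≡1+∣p∣ (x∉p ∘ there))

p⊆q∧∣q∣≤∣p∣⇒p≡q : {p q : Subset n} → p ⊆ q → ∣ q ∣ ≤ ∣ p ∣ → p ≡ q
p⊆q∧∣q∣≤∣p∣⇒p≡q {p = p} {q} p⊆q ∣q∣≤∣p∣ = ⊆-antisym p⊆q q⊆p
  where
  q⊆p : q ⊆ p
  q⊆p {x} x∈q = decidable-stable (x ∈? p) λ x∉p →
    ≤⇒≯ ∣q∣≤∣p∣ (p⊂q⇒∣p∣<∣q∣ (p⊆q , x , x∈q , x∉p))

∣p∣<∣q∣⇒∃∈q∖p : {p q : Subset n} → ∣ p ∣ < ∣ q ∣ → ∃ λ x → x ∈ q × x ∉ p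
∣p∣<∣q∣⇒∃∈q∖p {p = p} {q} ∣p∣<∣q∣ =
  decidable-stable (any? λ x → (x ∈? q) ×-dec ¬? (x ∈? p)) λ none →
    <⇒≱ ∣p∣<∣q∣ (p⊆q⇒∣p∣≤∣q∣ λ {x} x∈q → decidable-stable (x ∈? p) λ x∉p → none (x , x∈q , x∉p))

length-filter+length-filter-∁ : {A : Set} {P : A → Set} (P? : Decidable P) (xs : List A) →
  length (filter P? xs) + length (filter (∁? P?) xs) ≡ length xs
length-filter+length-filter-∁ P? [] = refl
length-filter+length-filter-∁ P? (x ∷ xs) with P? x
... | yes _ = cong suc (length-filter+length-filter-∁ P? xs)
... | no _  = trans (+-suc _ _) (cong suc (length-filter+length-filter-∁ P? xs))

decoded-length≤∣q∣ : {A : Set} {xs : List A} {q : Subset n} (decode : Fin n → A) → Unique xs →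
  All (λ a → ∃ λ y → y ∈ q × decode y ≡ a) xs → length xs ≤ ∣ q ∣
decoded-length≤∣q∣ decode [] [] = z≤n
decoded-length≤∣q∣ {q = q} decode (x∉xs ∷ uniq) ((y , y∈q , refl) ∷ codes) =
  ≤-trans (s≤s (decoded-length≤∣q∣ decode uniq (All.zipWith recode (x∉xs , codes)))) (x∈p⇒∣p-x∣<∣p∣ y∈q)
  where
  recode : ∀ {a} → decode y ≢ a × (∃ λ z → z ∈ q × decode z ≡ a) → ∃ λ z → z ∈ q - y × decode z ≡ a
  recode (y≢a , z , z∈q , refl) = z , x∈p∧x≢y⇒x∈p-y z∈q (λ { refl → y≢a refl }) , refl

one-point-extensions-count : {p r : Subset n} {Gs : List (Subset n)} → Unique Gs →
  All (λ G → p ⊆ G × ∣ G ∣ ≡ suc ∣ p ∣ × (∀ {x} → x ∈ r → x ∉ G)) Gs →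
  length Gs ≤ n ∸ ∣ r ∪ p ∣
one-point-extensions-count {n} {p} {r} uniq extensions =
  subst (_ ≤_) (∣∁p∣≡n∸∣p∣ (r ∪ p)) (decoded-length≤∣q∣ (λ y → ⁅ y ⁆ ∪ p) uniq (All.map code extensions))
  where
  code : ∀ {G} → p ⊆ G × ∣ G ∣ ≡ suc ∣ p ∣ × (∀ {x} → x ∈ r → x ∉ G) →
    ∃ λ y → y ∈ ∁ (r ∪ p) × ⁅ y ⁆ ∪ p ≡ G
  code (p⊆G , ∣G∣≡1+∣p∣ , r∉G) with ∣p∣<∣q∣⇒∃∈q∖p (≤-reflexive (sym ∣G∣≡1+∣p∣))
  ... | y , y∈G , y∉p =
    y ,
    x∉p⇒x∈∁p (λ y∈r∪p → [ (λ y∈r → r∉G y∈r y∈G) , y∉p ] (x∈p∪q⁻ r p y∈r∪p)) ,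
    p⊆q∧∣q∣≤∣p∣⇒p≡q (p⊆r∧q⊆r⇒p∪q⊆r (x∈p⇒⁅x⁆⊆p y∈G) p⊆G) (≤-reflexive (trans ∣G∣≡1+∣p∣ (sym (∣⁅x⁆∪p∣≡1+∣p∣ y∉p))))

record Distinct₄ (u a b c : Fin n) : Set where
  field
    u≢a : u ≢ a
    u≢b : u ≢ b
    u≢c : u ≢ c
    a≢b : a ≢ b
    a≢c : a ≢ c
    b≢c : b ≢ c

-- Split according to whether b ∈ G: then G is {u, a, b} plus one point,
-- and otherwise {u, a, c} plus one point other than b.
through-pair-meeting-pair-count : {u a b c : Fin n} → Distinct₄ u a b c →
  {Gs : List (Subset n)} → Unique Gs →
  All (λ G → ∣ G ∣ ≡ 4 × u ∈ G × a ∈ G × (b ∈ G ⊎ c ∈ G)) Gs →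
  length Gs ≤ (n ∸ 3) + (n ∸ 4)
through-pair-meeting-pair-count {n} {u} {a} {b} {c} distinct {Gs} uniq members = begin
  length Gs                                                     ≡⟨ sym (length-filter+length-filter-∁ (b ∈?_) Gs) ⟩
  length (filter (b ∈?_) Gs) + length (filter (∁? (b ∈?_)) Gs) ≤⟨ +-mono-≤ withB withoutB ⟩
  (n ∸ 3) + (n ∸ 4)                                             ∎
  where
  open ≤-Reasoning
  open Distinct₄ distinct

  ∣⁅u,a,x⁆∣≡3 : ∀ {x} → u ≢ x → a ≢ x → ∣ ⁅ u ⁆ ∪ ⁅ a ⁆ ∪ ⁅ x ⁆ ∣ ≡ 3
  ∣⁅u,a,x⁆∣≡3 {x} u≢x a≢x = begin-equality
    ∣ ⁅ u ⁆ ∪ ⁅ a ⁆ ∪ ⁅ x ⁆ ∣ ≡⟨ ∣⁅x⁆∪p∣≡1+∣p∣ (x∉⁅y⁆∪p u≢a (x≢y⇒x∉⁅y⁆ u≢x)) ⟩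
    suc ∣ ⁅ a ⁆ ∪ ⁅ x ⁆ ∣     ≡⟨ cong suc (∣⁅x⁆∪p∣≡1+∣p∣ (x≢y⇒x∉⁅y⁆ a≢x)) ⟩
    suc (suc ∣ ⁅ x ⁆ ∣)       ≡⟨ cong (2 +_) (∣⁅x⁆∣≡1 x) ⟩
    3                         ∎

  ⁅u,a,x⁆⊆ : ∀ {x G} → u ∈ G → a ∈ G → x ∈ G → ⁅ u ⁆ ∪ ⁅ a ⁆ ∪ ⁅ x ⁆ ⊆ G
  ⁅u,a,x⁆⊆ u∈G a∈G x∈G =
    p⊆r∧q⊆r⇒p∪q⊆r (x∈p⇒⁅x⁆⊆p u∈G) (p⊆r∧q⊆r⇒p∪q⊆r (x∈p⇒⁅x⁆⊆p a∈G) (x∈p⇒⁅x⁆⊆p x∈G))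

  withB : length (filter (b ∈?_) Gs) ≤ n ∸ 3
  withB = subst (λ k → length (filter (b ∈?_) Gs) ≤ n ∸ k)
    (trans (cong ∣_∣ (∪-identityˡ (⁅ u ⁆ ∪ ⁅ a ⁆ ∪ ⁅ b ⁆))) (∣⁅u,a,x⁆∣≡3 u≢b a≢b))
    (one-point-extensions-count {r = ⊥} (Unique.filter⁺ (b ∈?_) uniq)
      (All.zipWith extension (all-filter (b ∈?_) Gs , filter⁺ (b ∈?_) members)))
    where
    extension : ∀ {G} → b ∈ G × (∣ G ∣ ≡ 4 × u ∈ G × a ∈ G × (b ∈ G ⊎ c ∈ G)) →
      ⁅ u ⁆ ∪ ⁅ a ⁆ ∪ ⁅ b ⁆ ⊆ G × ∣ G ∣ ≡ suc ∣ ⁅ u ⁆ ∪ ⁅ a ⁆ ∪ ⁅ b ⁆ ∣ × (∀ {x} → x ∈ ⊥ → x ∉ G)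
    extension (b∈G , ∣G∣≡4 , u∈G , a∈G , _) =
      ⁅u,a,x⁆⊆ u∈G a∈G b∈G , trans ∣G∣≡4 (cong suc (sym (∣⁅u,a,x⁆∣≡3 u≢b a≢b))) , λ x∈⊥ → ⊥-elim (∉⊥ x∈⊥)

  withoutB : length (filter (∁? (b ∈?_)) Gs) ≤ n ∸ 4
  withoutB = subst (λ k → length (filter (∁? (b ∈?_)) Gs) ≤ n ∸ k)
    (trans (∣⁅x⁆∪p∣≡1+∣p∣ (x∉⁅y⁆∪p (u≢b ∘ sym) (x∉⁅y⁆∪p (a≢b ∘ sym) (x≢y⇒x∉⁅y⁆ b≢c))))
           (cong suc (∣⁅u,a,x⁆∣≡3 u≢c a≢c)))
    (one-point-extensions-count {r = ⁅ b ⁆} (Unique.filter⁺ (∁? (b ∈?_)) uniq)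
      (All.zipWith extension (all-filter (∁? (b ∈?_)) Gs , filter⁺ (∁? (b ∈?_)) members)))
    where
    extension : ∀ {G} → b ∉ G × (∣ G ∣ ≡ 4 × u ∈ G × a ∈ G × (b ∈ G ⊎ c ∈ G)) →
      ⁅ u ⁆ ∪ ⁅ a ⁆ ∪ ⁅ c ⁆ ⊆ G × ∣ G ∣ ≡ suc ∣ ⁅ u ⁆ ∪ ⁅ a ⁆ ∪ ⁅ c ⁆ ∣ × (∀ {x} → x ∈ ⁅ b ⁆ → x ∉ G)
    extension (b∉G , ∣G∣≡4 , u∈G , a∈G , b∈G⊎c∈G) =
      ⁅u,a,x⁆⊆ u∈G a∈G (fromInj₂ (⊥-elim ∘ b∉G) b∈G⊎c∈G) ,
      trans ∣G∣≡4 (cong suc (sym (∣⁅u,a,x⁆∣≡3 u≢c a≢c))) ,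
      λ {x} x∈⁅b⁆ → subst (_∉ _) (sym (x∈⁅y⁆⇒x≡y b x∈⁅b⁆)) b∉G

-- A member of G₂ contains two points of the core, so it meets every pair of core points.
InG2⇒e₁∨e₂ : {x e₁ e₂ : Fin n} {G : Subset n} → InG2 x e₁ e₂ G → e₁ ∈ G ⊎ e₂ ∈ G
InG2⇒e₁∨e₂ (_ , inj₁ (e₁∈G , _))   = inj₁ e₁∈G
InG2⇒e₁∨e₂ (_ , inj₂ (_ , e₁∨e₂)) = e₁∨e₂

InG2⇒x∨e₁ : {x e₁ e₂ : Fin n} {G : Subset n} → InG2 x e₁ e₂ G → x ∈ G ⊎ e₁ ∈ G
InG2⇒x∨e₁ (_ , inj₁ (e₁∈G , _)) = inj₂ e₁∈G
InG2⇒x∨e₁ (_ , inj₂ (x∈G , _))  = inj₁ x∈G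

InG2⇒x∨e₂ : {x e₁ e₂ : Fin n} {G : Subset n} → InG2 x e₁ e₂ G → x ∈ G ⊎ e₂ ∈ G
InG2⇒x∨e₂ (_ , inj₁ (_ , e₂∈G)) = inj₂ e₂∈G
InG2⇒x∨e₂ (_ , inj₂ (x∈G , _))  = inj₁ x∈G

∉core⇒≢ : {x e₁ e₂ u : Fin n} → u ∉ core x e₁ e₂ → u ≢ x × u ≢ e₁ × u ≢ e₂
∉core⇒≢ {u = u} u∉core =
  (λ { refl → u∉core (x∈p∪q⁺ (inj₁ (x∈⁅x⁆ u))) }) ,
  (λ { refl → u∉core (x∈p∪q⁺ (inj₂ (x∈p∪q⁺ (inj₁ (x∈⁅x⁆ u))))) }) ,
  (λ { refl → u∉core (x∈p∪q⁺ (inj₂ (x∈p∪q⁺ (inj₂ (x∈⁅x⁆ u))))) })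

core-pair-avoiding : {x e₁ e₂ u v : Fin n} → e₁ ≢ e₂ → x ≢ e₁ → x ≢ e₂ →
  u ∉ core x e₁ e₂ → u ≢ v →
  ∃₂ λ b c → Distinct₄ u v b c × (∀ {G} → InG2 x e₁ e₂ G → b ∈ G ⊎ c ∈ G)
core-pair-avoiding {x = x} {e₁} {e₂} {u} {v} e₁≢e₂ x≢e₁ x≢e₂ u∉core u≢v = pick (v ≟ᶠ x) (v ≟ᶠ e₁)
  where
  u≢x : u ≢ x
  u≢x = proj₁ (∉core⇒≢ u∉core)
  u≢e₁ : u ≢ e₁
  u≢e₁ = proj₁ (proj₂ (∉core⇒≢ u∉core))
  u≢e₂ : u ≢ e₂
  u≢e₂ = proj₂ (proj₂ (∉core⇒≢ u∉core))

  distinct : ∀ {b c} → u ≢ b → u ≢ c → v ≢ b → v ≢ c → b ≢ c → Distinct₄ u v b c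
  distinct u≢b u≢c v≢b v≢c b≢c = record
    { u≢a = u≢v ; u≢b = u≢b ; u≢c = u≢c ; a≢b = v≢b ; a≢c = v≢c ; b≢c = b≢c }

  pick : Dec (v ≡ x) → Dec (v ≡ e₁) →
    ∃₂ λ b c → Distinct₄ u v b c × (∀ {G} → InG2 x e₁ e₂ G → b ∈ G ⊎ c ∈ G)
  pick (yes refl) _          = e₁ , e₂ , distinct u≢e₁ u≢e₂ x≢e₁ x≢e₂ e₁≢e₂ , InG2⇒e₁∨e₂
  pick (no v≢x)   (yes refl) = x , e₂ , distinct u≢x u≢e₂ v≢x e₁≢e₂ x≢e₂ , InG2⇒x∨e₂
  pick (no v≢x)   (no v≢e₁)  = x , e₁ , distinct u≢x u≢e₁ v≢x v≢e₁ x≢e₁ , InG2⇒x∨e₁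

n∸3+n∸4≡2n∸7 : 4 ≤ n → (n ∸ 3) + (n ∸ 4) ≡ 2 * n ∸ 7
n∸3+n∸4≡2n∸7 {suc (suc (suc (suc k)))} (s≤s (s≤s (s≤s (s≤s _))))
  rewrite +-identityʳ k | +-suc k (3 + k) | +-suc k (2 + k) | +-suc k (1 + k) | +-suc k k = refl

module _ {F : Family n} (uniq : Unique F) (four-sets : All (λ G → ∣ G ∣ ≡ 4) F)
         {x e₁ e₂ : Fin n} (e₁≢e₂ : e₁ ≢ e₂) (x≢e₁ : x ≢ e₁) (x≢e₂ : x ≢ e₂)
         (inG2 : All (InG2 x e₁ e₂) F) where

  d≤2n∸7 : 4 ≤ n → {u v : Fin n} → u ∉ core x e₁ e₂ → u ≢ v → d F (⁅ u ⁆ ∪ ⁅ v ⁆) ≤ 2 * n ∸ 7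
  d≤2n∸7 4≤n {u} {v} u∉core u≢v with core-pair-avoiding e₁≢e₂ x≢e₁ x≢e₂ u∉core u≢v
  ... | b , c , distinct , meets =
    subst (d F (⁅ u ⁆ ∪ ⁅ v ⁆) ≤_) (n∸3+n∸4≡2n∸7 4≤n)
      (through-pair-meeting-pair-count distinct (Unique.filter⁺ (⁅ u ⁆ ∪ ⁅ v ⁆ ⊆?_) uniq)
        (All.map member (All.zip (all-filter (⁅ u ⁆ ∪ ⁅ v ⁆ ⊆?_) F ,
           All.zip (filter⁺ (⁅ u ⁆ ∪ ⁅ v ⁆ ⊆?_) four-sets , filter⁺ (⁅ u ⁆ ∪ ⁅ v ⁆ ⊆?_) inG2)))))
    where
    member : ∀ {G} → ⁅ u ⁆ ∪ ⁅ v ⁆ ⊆ G × ∣ G ∣ ≡ 4 × InG2 x e₁ e₂ G →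
      ∣ G ∣ ≡ 4 × u ∈ G × v ∈ G × (b ∈ G ⊎ c ∈ G)
    member (uv⊆G , ∣G∣≡4 , G∈G₂) =
      ∣G∣≡4 , uv⊆G (x∈p∪q⁺ (inj₁ (x∈⁅x⁆ u))) , uv⊆G (x∈p∪q⁺ (inj₂ (x∈⁅x⁆ v))) , meets G∈G₂

  heavy-pair⇒∈core : 4 ≤ n → {u v : Fin n} → u ≢ v → d F (⁅ u ⁆ ∪ ⁅ v ⁆) > 2 * n ∸ 7 →
    u ∈ core x e₁ e₂
  heavy-pair⇒∈core 4≤n {u} u≢v heavy =
    decidable-stable (u ∈? core x e₁ e₂) λ u∉core → <⇒≱ heavy (d≤2n∸7 4≤n u∉core u≢v)

claim3p1 : (n : ℕ) → 9 ≤ n →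
    (F : Family n) → Unique F → All (λ G → ∣ G ∣ ≡ 4) F →
    (x e₁ e₂ : Fin n) → e₁ ≢ e₂ → x ≢ e₁ → x ≢ e₂ →
    All (InG2 x e₁ e₂) F →
    (x₁ x₂ : Fin n) → x₁ ≢ x₂ →
    d F (⁅ x₁ ⁆ ∪ ⁅ x₂ ⁆) > 2 * n ∸ 7 →
    (⁅ x₁ ⁆ ∪ ⁅ x₂ ⁆) ⊆ core x e₁ e₂
claim3p1 n 9≤n F uniq four-sets x e₁ e₂ e₁≢e₂ x≢e₁ x≢e₂ inG2 x₁ x₂ x₁≢x₂ heavy =
  p⊆r∧q⊆r⇒p∪q⊆r (x∈p⇒⁅x⁆⊆p (∈core x₁≢x₂ heavy))
                 (x∈p⇒⁅x⁆⊆p (∈core (x₁≢x₂ ∘ sym) (subst (λ S → d F S > 2 * n ∸ 7) (∪-comm ⁅ x₁ ⁆ ⁅ x₂ ⁆) heavy)))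
  where
  ∈core : ∀ {u v} → u ≢ v → d F (⁅ u ⁆ ∪ ⁅ v ⁆) > 2 * n ∸ 7 → u ∈ core x e₁ e₂
  ∈core = heavy-pair⇒∈core uniq four-sets e₁≢e₂ x≢e₁ x≢e₂ inG2 (≤-trans (s≤s (s≤s (s≤s (s≤s z≤n)))) 9≤n)
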